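{- Suppose $P_0,P_1,\dots,P_n$ are well quasi-ordered posets. Then $\prod_{i\le n}\mathbf{h}(P_i)$ is isomorphic to an induced suborder of $\prod_{i\le n}P_i$.
   Context: Products carry the componentwise order; each ordinal $\mathbf{h}(P_i)$ is regarded as a linear order. $\mathbf{h}(P)$ is the rank of the tree of non-empty strictly decreasing finite sequences of $P$ ordered by strict initial segment $\sqsubset$, i.e. the least ordinal $\gamma$ admitting $f$ into $\gamma$ with $s\sqsubset t\implies f(s)>f(t)$. A well quasi-order is a quasi-order with no infinite strictly decreasing sequences and no infinite antichains. -}

module Defs where

open import Level using (Level; _⊔_; suc)
open import Data.Nat using (ℕ) renaming (suc to sucℕ)
open import Data.Fin using (Fin)
open import Data.List using (List; []; _∷_; _++_)
open import Data.Product using (Σ; ∃; _×_; _,_)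
open import Data.Sum using (_⊎_)
open import Relation.Nullary using (¬_)
open import Relation.Binary.Core using (Rel)
open import Relation.Binary.Bundles using (Poset)
open import Relation.Binary.Structures using (IsStrictTotalOrder)
open import Relation.Binary.PropositionalEquality using (_≡_; _≢_)
open import Induction.WellFounded using (WellFounded)

module _ {c ℓ₁ ℓ₂ : Level} (P : Poset c ℓ₁ ℓ₂) where
  open Poset P

  _<P_ : Rel Carrier (ℓ₁ ⊔ ℓ₂)
  x <P y = (x ≤ y) × ¬ (x ≈ y)

  IsWQO : Set (c ⊔ ℓ₁ ⊔ ℓ₂)
  IsWQO = ¬ (Σ (ℕ → Carrier) λ f → ∀ k → f (sucℕ k) <P f k)
        × ¬ (Σ (ℕ → Carrier) λ f → ∀ i j → i ≢ j → ¬ (f i ≤ f j))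

  data Decr : List Carrier → Set (c ⊔ ℓ₁ ⊔ ℓ₂) where
    one  : ∀ x → Decr (x ∷ [])
    cons : ∀ x y xs → y <P x → Decr (y ∷ xs) → Decr (x ∷ y ∷ xs)

  -- nodes of the tree of non-empty strictly decreasing finite sequences of P
  Node : Set (c ⊔ ℓ₁ ⊔ ℓ₂)
  Node = Σ (List Carrier) Decr

  _⊏_ : Node → Node → Set c
  (s , _) ⊏ (t , _) = Σ (List Carrier) λ ys → (ys ≢ []) × (s ++ ys ≡ t)

record Ordinal (o : Level) : Set (suc o) where
  field
    Carrier : Set o
    _<_     : Rel Carrier o
    isSTO   : IsStrictTotalOrder _≡_ _<_
    wf      : WellFounded _<_

  _≤_ : Rel Carrier o
  x ≤ y = (x < y) ⊎ (x ≡ y)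

open Ordinal public using () renaming (Carrier to ⟦_⟧)

-- γ ≤ δ for ordinals: there is a strictly increasing map γ → δ
_≼_ : ∀ {o} → Ordinal o → Ordinal o → Set o
γ ≼ δ = Σ (⟦ γ ⟧ → ⟦ δ ⟧) λ g → ∀ x y → Ordinal._<_ γ x y → Ordinal._<_ δ (g x) (g y)

module _ {c ℓ₁ ℓ₂ : Level} (P : Poset c ℓ₁ ℓ₂) where
  Admits : Ordinal (c ⊔ ℓ₁ ⊔ ℓ₂) → Set (c ⊔ ℓ₁ ⊔ ℓ₂)
  Admits γ = Σ (Node P → ⟦ γ ⟧) λ f → ∀ s t → _⊏_ P s t → Ordinal._<_ γ (f t) (f s)

  -- γ is (isomorphic to) h(P): the least ordinal admitting such a map
  IsHeight : Ordinal (c ⊔ ℓ₁ ⊔ ℓ₂) → Set (suc (c ⊔ ℓ₁ ⊔ ℓ₂))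
  IsHeight γ = Admits γ × (∀ δ → Admits δ → γ ≼ δ)

module Submission where

-- It suffices that each h(P) has a strictly increasing map into P: such a map from a linear order
-- into a poset is an order embedding, and the componentwise product of embeddings is one.  For a
-- single P with height H = h(P) the argument runs as follows.
--   * Ranks: since H admits the tree of decreasing sequences, every x ∈ P has a rank rk x ∈ H,
--     rk is strictly monotone, and each ordinal below rk x is the rank of some y < x.
--   * Minimality of H makes rk onto H.
--   * Elements of equal rank form an antichain, so each level is finite up to ≈.
--   * A transfinite recursion picks one element per level, increasingly, keeping each choice
--     extendable by threads reaching all higher levels; finiteness of the levels (a compactness
--     lemma, common-witness) carries this invariant through limit stages.

open import Defs
open import Level using (Level; _⊔_)
open import Data.Nat using (ℕ; zero; suc) renaming (_<_ to _<ℕ_)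
open import Data.Nat.Properties using (<-cmp; m<1+n⇒m<n∨m≡n)
open import Data.Fin using (Fin)
open import Data.Product using (Σ; _×_; _,_; proj₁; proj₂)
open import Data.Sum using (_⊎_; inj₁; inj₂)
open import Data.Empty using (⊥-elim)
open import Data.Unit using (⊤; tt)
open import Data.Empty.Irrelevant renaming (⊥-elim to ⊥-elim-irr)
open import Data.List using (List; []; _∷_; _++_)
open import Data.List.Relation.Unary.Any as Any using (Any; here; there)
open import Data.List.Relation.Unary.All as All using (All; []; _∷_)
open import Data.List.Relation.Unary.All.Properties using (¬Any⇒All¬)
open import Data.List.Membership.Propositional using (_∈_)
open import Function using (_∘_)
open import Relation.Nullary using (¬_; yes; no)
open import Relation.Binary.Core using (Rel)
open import Relation.Binary.Bundles using (Poset)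
open import Relation.Binary.Structures using (IsStrictTotalOrder)
open import Relation.Binary.Definitions using (Trichotomous; tri<; tri≈; tri>)
open import Relation.Binary.PropositionalEquality using (_≡_; _≢_; refl; sym; subst; isEquivalence)
open import Induction.WellFounded as WF using (Acc; acc)
open import Axiom.ExcludedMiddle using (ExcludedMiddle)
open import Axiom.DoubleNegationElimination using (em⇒dne)
import Relation.Binary.Construct.StrictToNonStrict as StrictToNonStrict
import Relation.Binary.Properties.Poset as PosetProperties
import Relation.Binary.Construct.NonStrictToStrict as NonStrictToStrict

module Classical (em : ∀ {ℓ} → ExcludedMiddle ℓ) where

  counterexample : ∀ {a b} {I : Set a} {T : I → Set b} → ¬ (∀ i → T i) → Σ I λ i → ¬ T i
  counterexample {I = I} {T} ¬all with em {P = Σ I λ i → ¬ T i}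
  ... | yes ce = ce
  ... | no ¬ce = ⊥-elim (¬all λ i → em⇒dne em λ ¬Ti → ¬ce (i , ¬Ti))

  minimal : ∀ {a r q} {A : Set a} {_<_ : Rel A r} (Q : A → Set q) {x : A} →
            Acc _<_ x → Q x → Σ A λ m → Q m × (∀ {y} → y < m → ¬ Q y)
  minimal {A = A} {_<_} Q {x} (acc rs) Qx with em {P = Σ A λ y → y < x × Q y}
  ... | yes (y , y<x , Qy) = minimal Q (rs y<x) Qy
  ... | no ¬below = x , Qx , λ y<x Qy → ¬below (_ , y<x , Qy)

  -- Finite compactness.  This is what lets a
  -- transfinite construction pass limit stages when the candidates at each stage are finite.
  common-witness : ∀ {a i r b t} {X : Set a} {I : Set i} (_⊑_ : I → I → Set r)
    (⊑-total : ∀ i j → (i ⊑ j) ⊎ (j ⊑ i)) (B : X → Set b) (T : I → X → Set t) →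
    (∀ {i j z} → i ⊑ j → T j z → T i z) → (l : List X) →
    (∀ i → Any (λ z → B z × T i z) l) → Any B l → Any (λ z → B z × (∀ i → T i z)) l
  common-witness {t = t} {X = X} {I = I} _⊑_ ⊑-total B T T-down (x ∷ l) each some with em {P = B x}
  ... | no ¬Bx = there (common-witness _⊑_ ⊑-total B T T-down l
                          (λ i → Any.tail (¬Bx ∘ proj₁) (each i)) (Any.tail ¬Bx some))
  ... | yes Bx with em {P = ∀ i → T i x}
  ...   | yes Tx = here (Bx , Tx)
  ...   | no ¬Tx with counterexample ¬Tx
  ...     | i₀ , ¬Ti₀x =
            there (Any.map (λ (Bz , Tz) → Bz , proj₁ ∘ Tz)
                     (common-witness _⊑_ ⊑-total B T' T'-down l each' (Any.map proj₁ (each' i₀))))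
    where
      -- x fails T i₀, so strengthening every condition by T i₀ lets us discard x
      T' : I → X → Set t
      T' i z = T i z × T i₀ z
      T'-down : ∀ {i j z} → i ⊑ j → T' j z → T' i z
      T'-down i⊑j (Tj , Ti₀) = T-down i⊑j Tj , Ti₀
      each' : ∀ i → Any (λ z → B z × T' i z) l
      each' i with ⊑-total i i₀
      ... | inj₁ i⊑i₀ = Any.tail (¬Ti₀x ∘ proj₂ ∘ proj₂)
                          (Any.map (λ (Bz , Ti₀) → Bz , T-down i⊑i₀ Ti₀ , Ti₀) (each i₀))
      ... | inj₂ i₀⊑i = Any.tail (¬Ti₀x ∘ proj₂ ∘ proj₂)
                          (Any.map (λ (Bz , Ti) → Bz , Ti , T-down i₀⊑i Ti) (each i))

  -- Deterministic choice: the first member of l satisfying Q, or the default d if there is none.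
  -- It depends on Q only up to logical equivalence, which transfinite recursion needs.
  first : ∀ {a q} {X : Set a} (Q : X → Set q) → List X → X → X
  first Q [] d = d
  first Q (x ∷ l) d with em {P = Q x}
  ... | yes _ = x
  ... | no _ = first Q l d

  first-satisfies : ∀ {a q} {X : Set a} (Q : X → Set q) {l : List X} {d : X} →
                    Any Q l → Q (first Q l d)
  first-satisfies Q {x ∷ l} Ql with em {P = Q x}
  ... | yes Qx = Qx
  ... | no ¬Qx = first-satisfies Q (Any.tail ¬Qx Ql)

  first-inherits : ∀ {a q r} {X : Set a} (Q : X → Set q) (R : X → Set r) {l : List X} {d : X} →
                   All R l → R d → R (first Q l d)
  first-inherits Q R {[]} [] Rd = Rd
  first-inherits Q R {x ∷ l} (Rx ∷ Rl) Rd with em {P = Q x}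
  ... | yes _ = Rx
  ... | no _ = first-inherits Q R Rl Rd

  first-cong : ∀ {a q q'} {X : Set a} (Q : X → Set q) (Q' : X → Set q') →
               (∀ {z} → Q z → Q' z) → (∀ {z} → Q' z → Q z) →
               ∀ l {d} → first Q l d ≡ first Q' l d
  first-cong Q Q' to from [] = refl
  first-cong Q Q' to from (x ∷ l) with em {P = Q x} | em {P = Q' x}
  ... | yes _ | yes _ = refl
  ... | yes Qx | no ¬Q'x = ⊥-elim (¬Q'x (to Qx))
  ... | no ¬Qx | yes Q'x = ⊥-elim (¬Qx (from Q'x))
  ... | no _ | no _ = first-cong Q Q' to from l

no-descent : ∀ {a r} {A : Set a} {_<_ : Rel A r} (k : A → A) → (∀ {x y} → x < y → k x < k y) →
             ∀ {x} → Acc _<_ x → ¬ (k x < x)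
no-descent k k-mono (acc rs) kx<x = no-descent k k-mono (rs kx<x) (k-mono kx<x)

module OrdinalFacts {o} (H : Ordinal o) where
  open Ordinal H public using (wf) renaming (_<_ to _<ₒ_; _≤_ to _≤ₒ_)
  open IsStrictTotalOrder (Ordinal.isSTO H) public
    using () renaming (compare to compareₒ; trans to <ₒ-trans)
  open IsStrictTotalOrder (Ordinal.isSTO H) using (irrefl; <-resp-≈)
  open StrictToNonStrict _≡_ _<ₒ_ using (trans; total; <-≤-trans; ≤-<-trans)

  <ₒ-irrefl : ∀ {a} → ¬ (a <ₒ a)
  <ₒ-irrefl = irrefl refl

  ≤ₒ-refl : ∀ {a} → a ≤ₒ a
  ≤ₒ-refl = inj₂ refl

  ≤ₒ-trans : ∀ {a b d} → a ≤ₒ b → b ≤ₒ d → a ≤ₒ d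
  ≤ₒ-trans = trans isEquivalence <-resp-≈ <ₒ-trans

  <ₒ-≤ₒ-trans : ∀ {a b d} → a <ₒ b → b ≤ₒ d → a <ₒ d
  <ₒ-≤ₒ-trans = <-≤-trans <ₒ-trans (proj₁ <-resp-≈)

  ≤ₒ-<ₒ-trans : ∀ {a b d} → a ≤ₒ b → b <ₒ d → a <ₒ d
  ≤ₒ-<ₒ-trans = ≤-<-trans sym <ₒ-trans (proj₂ <-resp-≈)

  ≤ₒ-total : ∀ a b → (a ≤ₒ b) ⊎ (b ≤ₒ a)
  ≤ₒ-total = total compareₒ

  ≰ₒ⇒>ₒ : ∀ {a b} → ¬ (a ≤ₒ b) → b <ₒ a
  ≰ₒ⇒>ₒ {a} {b} a≰b with compareₒ a b
  ... | tri< a<b _ _ = ⊥-elim (a≰b (inj₁ a<b))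
  ... | tri≈ _ a≡b _ = ⊥-elim (a≰b (inj₂ a≡b))
  ... | tri> _ _ b<a = b<a

  override : ∀ {a} {X : Set a} → (⟦ H ⟧ → X) → ⟦ H ⟧ → X → ⟦ H ⟧ → X
  override f b y γ with compareₒ γ b
  ... | tri< _ _ _ = f γ
  ... | tri≈ _ _ _ = y
  ... | tri> _ _ _ = f γ

  override-at : ∀ {a} {X : Set a} {f : ⟦ H ⟧ → X} {b y} → override f b y b ≡ y
  override-at {b = b} with compareₒ b b
  ... | tri< b<b _ _ = ⊥-elim (<ₒ-irrefl b<b)
  ... | tri≈ _ _ _ = refl
  ... | tri> _ _ b<b = ⊥-elim (<ₒ-irrefl b<b)

  override-below : ∀ {a} {X : Set a} {f : ⟦ H ⟧ → X} {b y γ} → γ <ₒ b → override f b y γ ≡ f γ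
  override-below {b = b} {γ = γ} γ<b with compareₒ γ b
  ... | tri< _ _ _ = refl
  ... | tri≈ γ≮b _ _ = ⊥-elim (γ≮b γ<b)
  ... | tri> γ≮b _ _ = ⊥-elim (γ≮b γ<b)

  ≮ₒ⇒≥ₒ : ∀ {a b} → ¬ (a <ₒ b) → b ≤ₒ a
  ≮ₒ⇒≥ₒ {a} {b} a≮b with compareₒ a b
  ... | tri< a<b _ _ = ⊥-elim (a≮b a<b)
  ... | tri≈ _ a≡b _ = inj₂ (sym a≡b)
  ... | tri> _ _ b<a = inj₁ b<a

module StrictFacts {c ℓ₁ ℓ₂} (P : Poset c ℓ₁ ℓ₂) where
  open Poset P
  open PosetProperties P public using (_<_; <-trans; <-respˡ-≈; <-respʳ-≈; <⇒≱)
  open NonStrictToStrict _≈_ _≤_ using () renaming (≤-<-trans to ≤-<-trans′)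

  ≤-<-trans : ∀ {x y z} → x ≤ y → y < z → x < z
  ≤-<-trans = ≤-<-trans′ trans antisym ≤-respˡ-≈

module _ {o c ℓ₁ ℓ₂} (H : Ordinal o) (P : Poset c ℓ₁ ℓ₂) (g : ⟦ H ⟧ → Poset.Carrier P)
         (g-mono : ∀ {a b} → Ordinal._<_ H a b → _<P_ P (g a) (g b)) where
  open OrdinalFacts H
  open Poset P using () renaming (_≤_ to _⊑_)
  open StrictFacts P using (<⇒≱)

  embedding-preserves : ∀ {a b} → a ≤ₒ b → g a ⊑ g b
  embedding-preserves (inj₁ a<b) = proj₁ (g-mono a<b)
  embedding-preserves (inj₂ refl) = Poset.refl P

  embedding-reflects : ∀ {a b} → g a ⊑ g b → a ≤ₒ b
  embedding-reflects {a} {b} ga⊑gb = ≮ₒ⇒≥ₒ λ b<a → <⇒≱ (g-mono b<a) ga⊑gb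

module Sequences {c ℓ₁ ℓ₂} (P : Poset c ℓ₁ ℓ₂) where
  open Poset P renaming (Carrier to A; refl to ≤-refl; trans to ≤-trans)
  open StrictFacts P

  last : ∀ {l} → Decr P l → A
  last (one x) = x
  last (cons _ _ _ _ d) = last d

  last≤head : ∀ {y ys} (d : Decr P (y ∷ ys)) → last d ≤ y
  last≤head (one _) = ≤-refl
  last≤head (cons _ _ _ y<x d) = ≤-trans (last≤head d) (proj₁ y<x)

  snoc : ∀ {l} (d : Decr P l) {y} → y < last d → Σ (Decr P (l ++ y ∷ [])) λ d' → last d' ≡ y
  snoc (one x) y<x = cons x _ [] y<x (one _) , refl
  snoc (cons x z zs z<x d) y<last with snoc d y<last
  ... | d' , last≡y = cons x z _ z<x d' , last≡y

  last-decreases : ∀ {l ys} (d : Decr P l) (d' : Decr P (l ++ ys)) → ys ≢ [] → last d' < last d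
  last-decreases (one x) (one .x) ys≢[] = ⊥-elim (ys≢[] refl)
  last-decreases (one x) (cons .x y ys y<x d') _ = ≤-<-trans (last≤head d') y<x
  last-decreases (cons x y xs _ d) (cons .x .y _ _ d') ys≢[] = last-decreases d d' ys≢[]

NoInfiniteAntichain : ∀ {c ℓ₁ ℓ₂} → Poset c ℓ₁ ℓ₂ → Set (c ⊔ ℓ₂)
NoInfiniteAntichain P = ¬ (Σ (ℕ → Carrier) λ f → ∀ i j → i ≢ j → ¬ (f i ≤ f j))
  where open Poset P

-- In a poset without infinite antichains, a set S whose comparable members are equivalent can be
-- listed, up to ≈, by finitely many of its members; otherwise choosing fresh members one after
-- another would produce an infinite antichain.
finite-antichain : (∀ {ℓ} → ExcludedMiddle ℓ) → ∀ {c ℓ₁ ℓ₂ s} (P : Poset c ℓ₁ ℓ₂) →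
  NoInfiniteAntichain P → (S : Poset.Carrier P → Set s) →
  (∀ {x y} → S x → S y → Poset._≤_ P x y → Poset._≈_ P x y) →
  Σ (List (Poset.Carrier P)) λ l → All S l × (∀ {x} → S x → Any (Poset._≈_ P x) l)
finite-antichain em {c} {ℓ₁} {s = s} P no-antichain S S-antichain with em {P = Listing}
  where
    open Poset P using (_≈_) renaming (Carrier to A)
    Listing : Set (c ⊔ ℓ₁ ⊔ s)
    Listing = Σ (List A) λ l → All S l × (∀ {x} → S x → Any (x ≈_) l)
... | yes listing = listing
... | no ¬listing = ⊥-elim (no-antichain (xs , antichain))
  where
    open Poset P using (_≤_; _≈_; module Eq) renaming (Carrier to A)

    Fresh : List A → A → Set (c ⊔ ℓ₁ ⊔ s)
    Fresh l x = S x × All (λ z → ¬ x ≈ z) l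

    fresh : ∀ l → All S l → Σ A (Fresh l)
    fresh l Sl with em {P = Σ A (Fresh l)}
    ... | yes f = f
    ... | no ¬f = ⊥-elim (¬listing (l , Sl , λ {x} Sx →
                    em⇒dne em λ ¬covered → ¬f (x , Sx , ¬Any⇒All¬ l ¬covered)))

    grow : Σ (List A) (All S) → Σ (List A) (All S)
    grow (l , Sl) = proj₁ (fresh l Sl) ∷ l , proj₁ (proj₂ (fresh l Sl)) ∷ Sl

    stage : ℕ → Σ (List A) (All S)
    stage zero = [] , []
    stage (suc k) = grow (stage k)

    xs : ℕ → A
    xs k = proj₁ (fresh (proj₁ (stage k)) (proj₂ (stage k)))

    xs-S : ∀ k → S (xs k)
    xs-S k = proj₁ (proj₂ (fresh (proj₁ (stage k)) (proj₂ (stage k))))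

    xs-fresh : ∀ k → All (λ z → ¬ xs k ≈ z) (proj₁ (stage k))
    xs-fresh k = proj₂ (proj₂ (fresh (proj₁ (stage k)) (proj₂ (stage k))))

    earlier-listed : ∀ {i j} → i <ℕ j → xs i ∈ proj₁ (stage j)
    earlier-listed {i} {suc j} i<1+j with m<1+n⇒m<n∨m≡n i<1+j
    ... | inj₁ i<j = there (earlier-listed i<j)
    ... | inj₂ refl = here refl

    antichain : ∀ i j → i ≢ j → ¬ (xs i ≤ xs j)
    antichain i j i≢j xi≤xj with <-cmp i j
    ... | tri< i<j _ _ = All.lookup (xs-fresh j) (earlier-listed i<j)
                           (Eq.sym (S-antichain (xs-S i) (xs-S j) xi≤xj))
    ... | tri≈ _ i≡j _ = i≢j i≡j
    ... | tri> _ _ j<i = All.lookup (xs-fresh i) (earlier-listed j<i)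
                           (S-antichain (xs-S i) (xs-S j) xi≤xj)

-- The initial segment {γ | γ < β} of an ordinal is itself an ordinal.  Membership is an irrelevant
-- field, so that equality of elements is equality of their values.
module Segment {o} (H : Ordinal o) where
  open OrdinalFacts H

  record Below (β : ⟦ H ⟧) : Set o where
    constructor below
    field
      value : ⟦ H ⟧
      .is-below : value <ₒ β
  open Below public

  -- the membership proof can be recovered, as _<ₒ_ is trichotomous
  value<β : ∀ {β} (a : Below β) → value a <ₒ β
  value<β {β} (below γ γ<β) with compareₒ γ β
  ... | tri< γ<β′ _ _ = γ<β′
  ... | tri≈ _ refl _ = ⊥-elim-irr (<ₒ-irrefl γ<β)
  ... | tri> _ _ β<γ = ⊥-elim-irr (<ₒ-irrefl (<ₒ-trans γ<β β<γ))

  segment : ⟦ H ⟧ → Ordinal o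
  segment β = record
    { Carrier = Below β
    ; _<_ = _<ᵦ_
    ; isSTO = record
        { isStrictPartialOrder = record
            { isEquivalence = isEquivalence
            ; irrefl = λ { refl → <ₒ-irrefl }
            ; trans = <ₒ-trans
            ; <-resp-≈ = (λ { refl a<b → a<b }) , (λ { refl a<b → a<b })
            }
        ; compare = compareᵦ
        }
    ; wf = λ a → accessible (wf (value a))
    }
    where
      _<ᵦ_ : Below β → Below β → Set o
      a <ᵦ b = value a <ₒ value b

      compareᵦ : Trichotomous _≡_ _<ᵦ_
      compareᵦ (below a _) (below b _) with compareₒ a b
      ... | tri< a<b a≢b a≯b = tri< a<b (λ { refl → a≢b refl }) a≯b
      ... | tri≈ a≮b refl a≯b = tri≈ a≮b refl a≯b
      ... | tri> a≮b a≢b a>b = tri> a≮b (λ { refl → a≢b refl }) a>b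

      accessible : ∀ {a} → Acc _<ₒ_ (value a) → Acc _<ᵦ_ a
      accessible (acc rs) = acc λ b<a → accessible (rs b<a)

module Ranks (em : ∀ {ℓ} → ExcludedMiddle ℓ) {c ℓ₁ ℓ₂} (P : Poset c ℓ₁ ℓ₂)
             (H : Ordinal (c ⊔ ℓ₁ ⊔ ℓ₂)) (admits : Admits P H) where
  open Classical em
  open OrdinalFacts H
  open Sequences P
  open StrictFacts P
  open Poset P using () renaming (Carrier to A)

  private
    o : Level
    o = c ⊔ ℓ₁ ⊔ ℓ₂
    Ω : Set o
    Ω = ⟦ H ⟧
    f : Node P → Ω
    f = proj₁ admits
    f-decreasing : ∀ s t → _⊏_ P s t → f t <ₒ f s
    f-decreasing = proj₂ admits

  data Rk : A → Ω → Set o where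
    rank : ∀ {x α} →
           (∀ {y} → y < x → Σ Ω λ β → Rk y β × β <ₒ α) →
           (∀ {γ} → γ <ₒ α → Σ A λ y → y < x × Σ Ω λ β → Rk y β × γ ≤ₒ β) →
           Rk x α

  -- Ranks are unique: a smaller candidate would lie at or below the rank of some y < x, yet above
  -- it; recursion is on the first derivation.
  Rk-unique : ∀ {x α α'} → Rk x α → Rk x α' → α ≡ α'
  Rk-unique {α = α} {α'} (rank above least) (rank above' least') with compareₒ α α'
  ... | tri≈ _ α≡α' _ = α≡α'
  ... | tri< α<α' _ _ with least' α<α'
  ...   | y , y<x , β , rβ , α≤β with above y<x
  ...     | β' , rβ' , β'<α =
              ⊥-elim (<ₒ-irrefl (≤ₒ-<ₒ-trans α≤β (subst (_<ₒ α) (Rk-unique rβ' rβ) β'<α)))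
  Rk-unique {α = α} {α'} (rank above least) (rank above' least') | tri> _ _ α'<α
    with least α'<α
  ... | y , y<x , β , rβ , α'≤β with above' y<x
  ...   | β' , rβ' , β'<α' =
            ⊥-elim (<ₒ-irrefl (≤ₒ-<ₒ-trans α'≤β (subst (_<ₒ α') (sym (Rk-unique rβ rβ')) β'<α')))

  -- By induction on f d:
  -- each y below the last entry extends d, so has rank below f d; the rank is then the least
  -- bound of these.
  rank-exists : ∀ {α} → Acc _<ₒ_ α → ∀ {l} (d : Decr P l) → f (l , d) ≡ α →
                Σ Ω λ β → Rk (last d) β × β ≤ₒ α
  rank-exists {α} (acc rs) {l} d refl = m , rank m-above m-least , m≤α
    where
      x : A
      x = last d

      ranked-below : ∀ {y} → y < x → Σ Ω λ β → Rk y β × β <ₒ α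
      ranked-below y<x with snoc d y<x
      ... | d' , last≡y with f-decreasing (l , d) (_ , d') (_ ∷ [] , (λ ()) , refl)
      ...   | fd'<α with rank-exists (rs fd'<α) d' refl
      ...     | β , rβ , β≤ = β , subst (λ z → Rk z β) last≡y rβ , ≤ₒ-<ₒ-trans β≤ fd'<α

      Bound : Ω → Set o
      Bound γ = ∀ {y} → y < x → ∀ {β} → Rk y β → β <ₒ γ

      α-bound : Bound α
      α-bound y<x rβ with ranked-below y<x
      ... | β₀ , rβ₀ , β₀<α = subst (_<ₒ α) (Rk-unique rβ₀ rβ) β₀<α

      least-bound : Σ Ω λ m → Bound m × (∀ {γ} → γ <ₒ m → ¬ Bound γ)
      least-bound = minimal Bound (wf α) α-bound

      m : Ω
      m = proj₁ least-bound

      m-bound : Bound m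
      m-bound = proj₁ (proj₂ least-bound)

      m-minimal : ∀ {γ} → γ <ₒ m → ¬ Bound γ
      m-minimal = proj₂ (proj₂ least-bound)

      m≤α : m ≤ₒ α
      m≤α = ≮ₒ⇒≥ₒ λ α<m → m-minimal α<m α-bound

      m-above : ∀ {y} → y < x → Σ Ω λ β → Rk y β × β <ₒ m
      m-above y<x with ranked-below y<x
      ... | β , rβ , _ = β , rβ , m-bound y<x rβ

      m-least : ∀ {γ} → γ <ₒ m → Σ A λ y → y < x × Σ Ω λ β → Rk y β × γ ≤ₒ β
      m-least {γ} γ<m = em⇒dne em λ none →
        m-minimal γ<m λ y<x {β} rβ → ≰ₒ⇒>ₒ λ γ≤β → none (_ , y<x , β , rβ , γ≤β)

  rk : A → Ω
  rk x = proj₁ (rank-exists (wf _) (one x) refl)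

  rk-Rk : ∀ x → Rk x (rk x)
  rk-Rk x = proj₁ (proj₂ (rank-exists (wf _) (one x) refl))

  rk-mono : ∀ {x y} → y < x → rk y <ₒ rk x
  rk-mono {x} {y} y<x with rk-Rk x
  ... | rank above _ with above y<x
  ...   | β , rβ , β<rkx = subst (_<ₒ rk x) (Rk-unique rβ (rk-Rk y)) β<rkx

  rk-down : ∀ {x β} → β <ₒ rk x → Σ A λ y → y < x × β ≤ₒ rk y
  rk-down {x} β<rkx with rk-Rk x
  ... | rank _ least with least β<rkx
  ...   | y , y<x , β' , rβ' , β≤β' = y , y<x , subst (_ ≤ₒ_) (Rk-unique rβ' (rk-Rk y)) β≤β'

  -- Every ordinal below rk x is exactly the rank of some y < x: take y < x of least rank ≥ β.
  rk-exact : ∀ {x β} → β <ₒ rk x → Σ A λ y → y < x × rk y ≡ β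
  rk-exact {x} {β} β<rkx with rk-down β<rkx
  ... | y₀ , y₀<x , β≤rky₀ with minimal Reached (wf _) (y₀ , y₀<x , refl , β≤rky₀)
    where
      Reached : Ω → Set o
      Reached δ = Σ A λ y → y < x × rk y ≡ δ × β ≤ₒ δ
  ... | _ , (y , y<x , refl , inj₂ β≡rky) , _ = y , y<x , sym β≡rky
  ... | _ , (y , y<x , refl , inj₁ β<rky) , least with rk-down β<rky
  ...   | z , z<y , β≤rkz = ⊥-elim (least (rk-mono z<y) (z , <-trans z<y y<x , refl , β≤rkz))

module HeightChain (em : ∀ {ℓ} → ExcludedMiddle ℓ) {c ℓ₁ ℓ₂} (P : Poset c ℓ₁ ℓ₂)
                   (no-antichain : NoInfiniteAntichain P)
                   (H : Ordinal (c ⊔ ℓ₁ ⊔ ℓ₂)) (height : IsHeight P H) where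
  open Classical em
  open OrdinalFacts H
  open Sequences P
  open StrictFacts P
  open Ranks em P H (proj₁ height)
  open Poset P using (_≤_; _≈_) renaming (Carrier to A; refl to ≤-refl)

  private
    Ω : Set (c ⊔ ℓ₁ ⊔ ℓ₂)
    Ω = ⟦ H ⟧

  -- Every β is a rank: otherwise all ranks lie below β (ranks are downward closed), so the segment
  -- below β admits the rank map, and minimality of H embeds H into that segment, sending β below
  -- itself.
  rk-surjective : ∀ β → Σ A λ x → rk x ≡ β
  rk-surjective β with em {P = Σ A λ x → rk x ≡ β}
  ... | yes hit = hit
  ... | no miss = ⊥-elim (no-descent k k-mono (wf β) (value<β (proj₁ embedding β)))
    where
      open Segment H

      rk<β : ∀ x → rk x <ₒ β
      rk<β x with compareₒ (rk x) β
      ... | tri< rkx<β _ _ = rkx<β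
      ... | tri≈ _ rkx≡β _ = ⊥-elim (miss (x , rkx≡β))
      ... | tri> _ _ β<rkx = ⊥-elim (miss (proj₁ (rk-exact β<rkx) , proj₂ (proj₂ (rk-exact β<rkx))))

      segment-admits : Admits P (segment β)
      segment-admits = (λ (_ , d) → below (rk (last d)) (rk<β (last d))) ,
                       λ { (_ , d) (_ , d') (_ , ys≢[] , refl) →
                             rk-mono (last-decreases d d' ys≢[]) }

      embedding : H ≼ segment β
      embedding = proj₂ height (segment β) segment-admits

      k : Ω → Ω
      k γ = value (proj₁ embedding γ)

      k-mono : ∀ {γ δ} → γ <ₒ δ → k γ <ₒ k δ
      k-mono = proj₂ embedding _ _

  -- Each level is finite: elements of equal rank are comparable only when equivalent.
  level-listing : ∀ α → Σ (List A) λ l → All (λ z → rk z ≡ α) l × (∀ {x} → rk x ≡ α → Any (x ≈_) l)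
  level-listing α = finite-antichain em P no-antichain (λ x → rk x ≡ α) same-rank-antichain
    where
      same-rank-antichain : ∀ {x y} → rk x ≡ α → rk y ≡ α → x ≤ y → x ≈ y
      same-rank-antichain refl rky≡ x≤y = em⇒dne em λ x≉y →
        <ₒ-irrefl (subst (_ <ₒ_) rky≡ (rk-mono (x≤y , x≉y)))

  level : Ω → List A
  level α = proj₁ (level-listing α)

  level-sound : ∀ {α} → All (λ z → rk z ≡ α) (level α)
  level-sound {α} = proj₁ (proj₂ (level-listing α))

  level-complete : ∀ {α x} → rk x ≡ α → Any (x ≈_) (level α)
  level-complete {α} = proj₂ (proj₂ (level-listing α))

  record Thread {q r} (Bd : A → Set q) (I : Ω → Set r) (s : Ω → A) : Set (c ⊔ ℓ₁ ⊔ ℓ₂ ⊔ q ⊔ r) where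
    field
      ranked : ∀ {γ} → I γ → rk (s γ) ≡ γ
      inside : ∀ {γ} → I γ → Bd (s γ)
      increasing : ∀ {γ γ'} → I γ → I γ' → γ <ₒ γ' → s γ < s γ'
  open Thread

  thread-restrict : ∀ {q r r'} {Bd : A → Set q} {I : Ω → Set r} {J : Ω → Set r'} {s} →
                    (∀ {γ} → J γ → I γ) → Thread Bd I s → Thread Bd J s
  thread-restrict J⊆I t = record
    { ranked = ranked t ∘ J⊆I
    ; inside = inside t ∘ J⊆I
    ; increasing = λ Jγ Jγ' → increasing t (J⊆I Jγ) (J⊆I Jγ')
    }

  thread-enlarge : ∀ {q q' r} {Bd : A → Set q} {Bd' : A → Set q'} {I : Ω → Set r} {s} →
                   (∀ {z} → Bd z → Bd' z) → Thread Bd I s → Thread Bd' I s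
  thread-enlarge Bd⊆Bd' t = record
    { ranked = ranked t ; inside = Bd⊆Bd' ∘ inside t ; increasing = increasing t }

  [_,_] : Ω → Ω → Ω → Set (c ⊔ ℓ₁ ⊔ ℓ₂)
  [ a , b ] γ = a ≤ₒ γ × γ ≤ₒ b

  Reaches : ∀ {q} → (A → Set q) → A → Ω → Ω → Set (c ⊔ ℓ₁ ⊔ ℓ₂ ⊔ q)
  Reaches Bd z α β = Σ (Ω → A) λ s → Thread Bd [ α , β ] s × s α ≈ z

  reaches-lower : ∀ {q} {Bd : A → Set q} {z α β β'} → β ≤ₒ β' → Reaches Bd z α β' → Reaches Bd z α β
  reaches-lower β≤β' (s , t , sα≈z) =
    s , thread-restrict (λ (α≤γ , γ≤β) → α≤γ , ≤ₒ-trans γ≤β β≤β') t , sα≈z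

  thread-passes : ∀ {q} {Bd : A → Set q} {a α β s} → Thread Bd [ a , β ] s → a ≤ₒ α → α ≤ₒ β →
                  Any (λ z → s α ≈ z × Reaches Bd z α β) (level α)
  thread-passes {s = s} t a≤α α≤β =
    Any.map (λ sα≈z → sα≈z , s , thread-restrict (λ (α≤γ , γ≤β) → ≤ₒ-trans a≤α α≤γ , γ≤β) t , sα≈z)
            (level-complete (ranked t (a≤α , α≤β)))

  reaches-through : ∀ {q} {Bd : A → Set q} {x γ α β} → Reaches Bd x γ β → γ <ₒ α → α ≤ₒ β →
                    Any (λ z → Reaches Bd z α β × x < z) (level α)
  reaches-through {γ = γ} {α} {β} (s , t , sγ≈x) γ<α α≤β =
    Any.map (λ (sα≈z , reaches) → reaches ,
               <-respʳ-≈ sα≈z (<-respˡ-≈ sγ≈x (increasing t (≤ₒ-refl , γ≤β) (inj₁ γ<α , α≤β) γ<α)))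
            (thread-passes t (inj₁ γ<α) α≤β)
    where
      γ≤β : γ ≤ₒ β
      γ≤β = inj₁ (<ₒ-≤ₒ-trans γ<α α≤β)

  -- Stage α takes the first
  -- element of level α lying above the earlier choices and starting threads to every β ∈ Λ above α;
  -- such an element exists at limit stages too, by compactness of the finite level α.
  module ChainBuilder {q r} (Bd : A → Set q) (Bd-resp : ∀ {x y} → x ≈ y → Bd x → Bd y)
                      (Λ : Ω → Set r) (Λ-down : ∀ {γ β} → γ <ₒ β → Λ β → Λ γ)
                      (threads : ∀ {b} → Λ b → Σ (Ω → A) (Thread Bd (_≤ₒ b))) where

    Good : (α : Ω) → (∀ {γ} → γ <ₒ α → A) → A → Set (c ⊔ ℓ₁ ⊔ ℓ₂ ⊔ q ⊔ r)
    Good α IH z = (∀ {γ} (γ<α : γ <ₒ α) → IH γ<α < z) × (∀ {β} → α ≤ₒ β → Λ β → Reaches Bd z α β)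

    step : (α : Ω) → (∀ {γ} → γ <ₒ α → A) → A
    step α IH = first (Good α IH) (level α) (proj₁ (rk-surjective α))

    chain : Ω → A
    chain = WF.All.wfRec wf _ (λ _ → A) step

    chain-unfold : ∀ {α} → chain α ≡ step α (λ {γ} _ → chain γ)
    chain-unfold = WF.FixPoint.unfold-wfRec wf (λ _ → A) step step-ext
      where
        step-ext : ∀ α {IH IH' : ∀ {γ} → γ <ₒ α → A} →
                   (∀ {γ} (γ<α : γ <ₒ α) → IH γ<α ≡ IH' γ<α) → step α IH ≡ step α IH'
        step-ext α eq = first-cong _ _
          (λ (above , reaches) → (λ γ<α → subst (_< _) (eq γ<α) (above γ<α)) , reaches)
          (λ (above , reaches) → (λ γ<α → subst (_< _) (sym (eq γ<α)) (above γ<α)) , reaches)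
          (level α)

    GoodChain : Ω → A → Set (c ⊔ ℓ₁ ⊔ ℓ₂ ⊔ q ⊔ r)
    GoodChain α = Good α (λ {γ} _ → chain γ)

    -- For a fixed target
    -- β, the threads from the earlier choices, and the given thread up to β, pass level α; then
    -- common-witness makes one element serve all earlier choices, and then all targets β.
    good-exists : ∀ {α} → Λ α → (∀ {γ} → γ <ₒ α → GoodChain γ (chain γ)) →
                  Any (GoodChain α) (level α)
    good-exists {α} Λα good-below =
      Any.map (λ (above , reaches) →
                 (λ {γ} γ<α → above γ<α) , λ {β} α≤β Λβ → reaches (β , α≤β , Λβ))
        (common-witness (λ i j → proj₁ i ≤ₒ proj₁ j) (λ i j → ≤ₒ-total _ _) Above
                        (λ i z → Reaches Bd z α (proj₁ i)) reaches-lower (level α)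
                        reaching (Any.map proj₁ (reaching (α , ≤ₒ-refl , Λα))))
      where
        Above : A → Set (c ⊔ ℓ₁ ⊔ ℓ₂)
        Above z = ∀ {γ} → γ <ₒ α → chain γ < z

        reaching : (i : Σ Ω λ β → α ≤ₒ β × Λ β) →
                   Any (λ z → Above z × Reaches Bd z α (proj₁ i)) (level α)
        reaching (β , α≤β , Λβ) =
          Any.map (λ (reaches , above) → (λ {γ} γ<α → above (γ , γ<α)) , reaches)
            (common-witness {I = Σ Ω (_<ₒ α)} (λ i j → proj₁ i ≤ₒ proj₁ j) (λ i j → ≤ₒ-total _ _)
                            (λ z → Reaches Bd z α β) (λ i z → chain (proj₁ i) < z)
                            (λ {i} {j} → above-lower {i} {j})
                            (level α) via-earlier via-given)
          where
            above-lower : ∀ {i j : Σ Ω (_<ₒ α)} {z : A} → proj₁ i ≤ₒ proj₁ j →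
                          chain (proj₁ j) < z → chain (proj₁ i) < z
            above-lower {j = _ , γ'<α} (inj₁ γ<γ') above =
              <-trans (proj₁ (good-below γ'<α) γ<γ') above
            above-lower (inj₂ refl) above = above

            via-earlier : (i : Σ Ω (_<ₒ α)) →
                          Any (λ z → Reaches Bd z α β × chain (proj₁ i) < z) (level α)
            via-earlier (γ , γ<α) =
              reaches-through (proj₂ (good-below γ<α) (inj₁ (<ₒ-≤ₒ-trans γ<α α≤β)) Λβ) γ<α α≤β

            via-given : Any (λ z → Reaches Bd z α β) (level α)
            via-given = Any.map proj₂ (thread-passes (thread-restrict proj₂ (proj₂ (threads Λβ)))
                                                     ≤ₒ-refl α≤β)

    chain-good : ∀ {α} → Acc _<ₒ_ α → Λ α → GoodChain α (chain α)
    chain-good {α} (acc rs) Λα = subst (GoodChain α) (sym chain-unfold)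
      (first-satisfies (GoodChain α) (good-exists Λα λ γ<α → chain-good (rs γ<α) (Λ-down γ<α Λα)))

    chain-rank : ∀ α → rk (chain α) ≡ α
    chain-rank α = subst (λ z → rk z ≡ α) (sym chain-unfold)
      (first-inherits _ (λ z → rk z ≡ α) level-sound (proj₂ (rk-surjective α)))

    chain-inside : ∀ {α} → Λ α → Bd (chain α)
    chain-inside Λα with proj₂ (chain-good (wf _) Λα) ≤ₒ-refl Λα
    ... | s , t , sα≈chainα = Bd-resp sα≈chainα (inside t (≤ₒ-refl , ≤ₒ-refl))

    chain-increasing : ∀ {γ α} → γ <ₒ α → Λ α → chain γ < chain α
    chain-increasing γ<α Λα = proj₁ (chain-good (wf _) Λα) γ<α

  -- Below the top it is
  -- the chain built on the levels below rk y inside the strict down-set of y, the threads this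
  -- needs coming recursively from elements z < y of each smaller rank.
  thread-to : ∀ {b} → Acc _<ₒ_ b → ∀ y → rk y ≡ b →
              Σ (Ω → A) λ s → Thread (_≤ y) (_≤ₒ b) s × s b ≡ y
  thread-to {b} (acc rs) y refl =
    s , record { ranked = s-ranked ; inside = s-inside ; increasing = s-increasing } , s-top
    where
      threads-below : ∀ {b'} → b' <ₒ b → Σ (Ω → A) (Thread (_< y) (_≤ₒ b'))
      threads-below b'<b with rk-exact b'<b
      ... | z , z<y , rkz≡b' with thread-to (rs b'<b) z rkz≡b'
      ...   | s , t , _ = s , thread-enlarge (λ v≤z → ≤-<-trans v≤z z<y) t

      open ChainBuilder (_< y) (λ x≈x' x<y → <-respˡ-≈ x≈x' x<y) (_<ₒ b) <ₒ-trans threads-below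

      s : Ω → A
      s = override chain b y

      s-top : s b ≡ y
      s-top = override-at

      s-below : ∀ {γ} → γ <ₒ b → s γ ≡ chain γ
      s-below = override-below

      s-ranked : ∀ {γ} → γ ≤ₒ b → rk (s γ) ≡ γ
      s-ranked (inj₁ γ<b) rewrite s-below γ<b = chain-rank _
      s-ranked (inj₂ refl) rewrite s-top = refl

      s-inside : ∀ {γ} → γ ≤ₒ b → s γ ≤ y
      s-inside (inj₁ γ<b) rewrite s-below γ<b = proj₁ (chain-inside γ<b)
      s-inside (inj₂ refl) rewrite s-top = ≤-refl

      s-increasing : ∀ {γ γ'} → γ ≤ₒ b → γ' ≤ₒ b → γ <ₒ γ' → s γ < s γ'
      s-increasing _ (inj₁ γ'<b) γ<γ'
        rewrite s-below γ'<b | s-below (<ₒ-trans γ<γ' γ'<b) = chain-increasing γ<γ' γ'<b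
      s-increasing _ (inj₂ refl) γ<b rewrite s-top | s-below γ<b = chain-inside γ<b

  height-chain : Σ (Ω → A) λ g → ∀ {α β} → α <ₒ β → g α < g β
  height-chain = chain , λ α<β → chain-increasing α<β tt
    where
      threads : ∀ {b} → ⊤ → Σ (Ω → A) (Thread (λ _ → ⊤) (_≤ₒ b))
      threads {b} _ with rk-surjective b
      ... | y , refl with thread-to (wf _) y refl
      ...   | s , t , _ = s , thread-enlarge (λ _ → tt) t

      open ChainBuilder (λ _ → ⊤) (λ _ _ → tt) (λ _ → ⊤) (λ _ _ → tt) threads
        using (chain; chain-increasing)

lemma4p14 : (∀ {ℓ} → ExcludedMiddle ℓ) → {c ℓ₁ ℓ₂ : Level} →
    (n : ℕ) (P : Fin (suc n) → Poset c ℓ₁ ℓ₂) → (∀ i → IsWQO (P i)) →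
    (H : Fin (suc n) → Ordinal (c ⊔ ℓ₁ ⊔ ℓ₂)) → (∀ i → IsHeight (P i) (H i)) →
    Σ (((i : Fin (suc n)) → ⟦ H i ⟧) → ((i : Fin (suc n)) → Poset.Carrier (P i))) λ F →
      ∀ x y → ((∀ i → Ordinal._≤_ (H i) (x i) (y i)) → (∀ i → Poset._≤_ (P i) (F x i) (F y i)))
            × ((∀ i → Poset._≤_ (P i) (F x i) (F y i)) → (∀ i → Ordinal._≤_ (H i) (x i) (y i)))
lemma4p14 em n P wqo H heights = F , λ x y →
  (λ x≤y i → embedding-preserves (H i) (P i) (g i) (g-mono i) (x≤y i)) ,
  (λ Fx≤Fy i → embedding-reflects (H i) (P i) (g i) (g-mono i) (Fx≤Fy i))
  where
    -- only the absence of infinite antichains is needed from the wqo hypothesis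
    module Chain (i : Fin (suc n)) = HeightChain em (P i) (proj₂ (wqo i)) (H i) (heights i)

    g : ∀ i → ⟦ H i ⟧ → Poset.Carrier (P i)
    g i = proj₁ (Chain.height-chain i)

    g-mono : ∀ i {a b} → Ordinal._<_ (H i) a b → _<P_ (P i) (g i a) (g i b)
    g-mono i = proj₂ (Chain.height-chain i)

    F : ((i : Fin (suc n)) → ⟦ H i ⟧) → ((i : Fin (suc n)) → Poset.Carrier (P i))
    F x i = g i (x i)
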